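{- Let $G=(V,E)$ be a finite simple undirected graph, let $0<\gamma<1$, let $\gamma'$ satisfy $\gamma<\gamma'\le 1$, let $s\ge 1$ (the minimum size threshold) and let $k'\ge k\ge 1$ be integers. Suppose $\mathrm{QuickM}(G,X,\beta,s)$ denotes a procedure that, given a vertex set $X\subseteq V$ and $0<\beta\le1$, returns the collection of all $\beta$-quasi-cliques of $G$ (as vertex sets) that contain $X$ and have at least $s$ vertices (not necessarily only maximal ones). Consider the algorithm: $X_0\gets \mathrm{QuickM}(G,\emptyset,\gamma',s)$; $Y\gets \mathrm{KMax}(X_0,k')$; $Z\gets\bigcup_{q\in Y}\mathrm{QuickM}(G,q,\gamma,s)$; $R\gets \mathrm{KMax}(Z,k)$; return $R$. Then $R$ contains at most $k$ $\gamma$-quasi-cliques of $G$, each having at least $s$ vertices, and each member of $R$ is a maximal $\gamma$-quasi-clique of $G$.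
   Context: For $0<\beta\le 1$, a vertex-induced subgraph $Q$ of $G$ is a $\beta$-quasi-clique if $Q$ is connected and every vertex $v\in V(Q)$ has degree at least $\lceil \beta(|Q|-1)\rceil$ in $Q$, where $|Q|$ is the number of vertices of $Q$; quasi-cliques are identified with their vertex sets. A $\gamma$-quasi-clique $Q$ is maximal in $G$ if there is no $\gamma$-quasi-clique $Q'$ of $G$ with $V(Q)\subsetneq V(Q')$. The procedure $\mathrm{KMax}(S,k)$, for a finite collection $S$ of vertex sets and integer $k$, is: sort $S$ in non-increasing order of size; set $Q\gets\emptyset$; for each $q\in S$ in this order, if $|Q|<k$ and no $q'\in Q$ satisfies $q\subseteq q'$, add $q$ to $Q$; return $Q$. -}

module Defs where

open import Data.Nat as ℕ using (ℕ; _∸_; _<ᵇ_)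
open import Data.Integer as ℤ using (ℤ; +_)
open import Data.Rational as ℚ using (ℚ; _/_; ceiling)
open import Data.Bool using (Bool; true; false; if_then_else_; _∧_; not)
open import Data.Fin using (Fin)
open import Data.Fin.Subset using (Subset; _∈_; _⊆_; _⊂_; _∩_; ∣_∣)
open import Data.Fin.Subset.Properties using (_⊆?_)
open import Data.Vec using (tabulate)
open import Data.List using (List; []; _∷_; _++_; [_]; length)
open import Data.List.Relation.Unary.Any using (Any; any?)
open import Data.List.Relation.Unary.Linked using (Linked)
open import Data.List.Relation.Binary.Permutation.Propositional using (_↭_)
open import Data.Product using (Σ; _×_; ∃)
open import Relation.Nullary using (¬_; does)
open import Relation.Binary.PropositionalEquality using (_≡_)

record Graph (n : ℕ) : Set where
  field
    adj   : Fin n → Fin n → Bool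
    sym   : ∀ u v → adj u v ≡ adj v u
    irref : ∀ v → adj v v ≡ false

open Graph public

N : ∀ {n} → Graph n → Fin n → Subset n
N G v = tabulate (adj G v)

degIn : ∀ {n} → Graph n → Subset n → Fin n → ℕ
degIn G Q v = ∣ Q ∩ N G v ∣

data Reach {n} (G : Graph n) (Q : Subset n) : Fin n → Fin n → Set where
  here : ∀ {u} → u ∈ Q → Reach G Q u u
  step : ∀ {u w v} → u ∈ Q → adj G u w ≡ true → Reach G Q w v → Reach G Q u v

Connected : ∀ {n} → Graph n → Subset n → Set
Connected G Q = ∀ u v → u ∈ Q → v ∈ Q → Reach G Q u v

IsQC : ∀ {n} → Graph n → ℚ → Subset n → Set
IsQC G β Q =
  Connected G Q ×
  (∀ v → v ∈ Q → ceiling (β ℚ.* ((+ (∣ Q ∣ ∸ 1)) / 1)) ℤ.≤ + degIn G Q v)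

MaximalQC : ∀ {n} → Graph n → ℚ → Subset n → Set
MaximalQC G γ Q = IsQC G γ Q × (∀ Q' → Q ⊂ Q' → ¬ IsQC G γ Q')

kmaxLoop : ∀ {n} → ℕ → List (Subset n) → List (Subset n) → List (Subset n)
kmaxLoop k Q [] = Q
kmaxLoop k Q (q ∷ S) =
  if (length Q <ᵇ k) ∧ not (does (any? (q ⊆?_) Q))
  then kmaxLoop k (Q ++ [ q ]) S
  else kmaxLoop k Q S

SortedBySize : ∀ {n} → List (Subset n) → Set
SortedBySize = Linked (λ a b → ∣ b ∣ ℕ.≤ ∣ a ∣)

-- R is a possible output of KMax(S,k): for some ordering S' of S
-- in non-increasing order of size (ties broken arbitrarily), R is
-- the result of the greedy loop on S'.
IsKMax : ∀ {n} → List (Subset n) → ℕ → List (Subset n) → Set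
IsKMax S k R = Σ _ λ S' → (S' ↭ S) × SortedBySize S' × (R ≡ kmaxLoop k [] S')

-- KMax returns only members of its input that are ⊂-maximal there: a strict superset in
-- the input is larger, so it was inspected earlier, and it was then either accepted (and
-- covers the element) or rejected as covered or for lack of room, and each of these also
-- rejects the element. The list Z = ⋃_{q ∈ Y} QuickM(G, q, γ, s) is closed upwards among
-- γ-quasi-cliques, since a γ-quasi-clique containing a member of QuickM(G, q, γ, s) still
-- contains the seed q and is no smaller.
module Submission where

open import Defs
open import Data.Nat as ℕ using (ℕ; _<ᵇ_; _<_; _≤_; z≤n)
open import Data.Nat.Properties using (<ᵇ-reflects-<; _<?_; ≮⇒≥; ≤⇒≯; ≤-trans; ≤-reflexive; <⇒≤; <-irrefl; +-comm)
open import Data.Rational as ℚ using (ℚ; 0ℚ; 1ℚ)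
import Data.Rational.Properties as ℚ
open import Data.Fin.Subset using (Subset; ⊥; _⊆_; _⊂_; ∣_∣)
open import Data.Fin.Subset.Properties using (_⊆?_; ⊆-trans; p⊂q⇒∣p∣<∣q∣)
open import Data.List using (List; []; _∷_; _++_; [_]; length; concatMap)
open import Data.List.Properties using (length-++)
open import Data.List.Membership.Propositional as L using (_∈_)
open import Data.List.Membership.Propositional.Properties using (∈-++⁻; ∈-concatMap⁻; ∈-concatMap⁺)
open import Data.List.Relation.Unary.All as All using (All; tabulate)
open import Data.List.Relation.Unary.Any as Any using (Any; here; there; any?)
open import Data.List.Relation.Unary.Any.Properties using (++⁺ˡ; ++⁺ʳ)
open import Data.List.Relation.Unary.AllPairs using (AllPairs; []; _∷_)
open import Data.List.Relation.Unary.Linked.Properties using (Linked⇒AllPairs)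
open import Data.List.Relation.Binary.Permutation.Propositional.Properties using (∈-resp-↭)
open import Data.List.Relation.Binary.Permutation.Propositional using (↭-sym)
open import Data.Bool using (true; false)
open import Data.Sum using (_⊎_; inj₁; inj₂)
open import Data.Product using (_×_; _,_; proj₁; proj₂)
open import Function using (_∘_)
open import Relation.Nullary using (¬_; yes; no; contradiction)
open import Relation.Nullary.Reflects using (ofʸ; ofⁿ)
open import Relation.Binary.PropositionalEquality using (_≡_; refl; trans; subst)

⊂-Maximal : ∀ {n} → List (Subset n) → Subset n → Set
⊂-Maximal S r = r ∈ S × (∀ {q} → q ∈ S → ¬ r ⊂ q)

data KMaxStep {n} (k : ℕ) (A : List (Subset n)) (q : Subset n) (S : List (Subset n)) : Set where
  accept : length A < k → ¬ Any (q ⊆_) A →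
           kmaxLoop k A (q ∷ S) ≡ kmaxLoop k (A ++ [ q ]) S → KMaxStep k A q S
  reject : k ≤ length A ⊎ Any (q ⊆_) A →
           kmaxLoop k A (q ∷ S) ≡ kmaxLoop k A S → KMaxStep k A q S

kmaxLoop-accept : ∀ {n k} {A : List (Subset n)} {q} S → length A < k → ¬ Any (q ⊆_) A →
                  kmaxLoop k A (q ∷ S) ≡ kmaxLoop k (A ++ [ q ]) S
kmaxLoop-accept {k = k} {A} {q} S room uncovered
  with length A <ᵇ k | <ᵇ-reflects-< (length A) k | any? (q ⊆?_) A
... | true  | _        | no _        = refl
... | true  | _        | yes covered = contradiction covered uncovered
... | false | ofⁿ full | _           = contradiction room full

kmaxLoop-reject : ∀ {n k} {A : List (Subset n)} {q} S → k ≤ length A ⊎ Any (q ⊆_) A →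
                  kmaxLoop k A (q ∷ S) ≡ kmaxLoop k A S
kmaxLoop-reject {k = k} {A} {q} S reason
  with length A <ᵇ k | <ᵇ-reflects-< (length A) k | any? (q ⊆?_) A | reason
... | false | _        | _            | _            = refl
... | true  | _        | yes _        | _            = refl
... | true  | ofʸ room | no _         | inj₁ full    = contradiction room (≤⇒≯ full)
... | true  | _        | no uncovered | inj₂ covered = contradiction covered uncovered

kmaxStep : ∀ {n} k (A : List (Subset n)) q S → KMaxStep k A q S
kmaxStep k A q S with length A <? k | any? (q ⊆?_) A
... | yes room | no uncovered = accept room uncovered (kmaxLoop-accept S room uncovered)
... | yes _    | yes covered  = reject (inj₂ covered) (kmaxLoop-reject S (inj₂ covered))
... | no full  | _            = reject (inj₁ (≮⇒≥ full)) (kmaxLoop-reject S (inj₁ (≮⇒≥ full)))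

kmaxLoop-length≤ : ∀ {n} k (A S : List (Subset n)) → length A ≤ k → length (kmaxLoop k A S) ≤ k
kmaxLoop-length≤ k A []      bound = bound
kmaxLoop-length≤ k A (q ∷ S) bound with kmaxStep k A q S
... | accept room _ eq rewrite eq =
  kmaxLoop-length≤ k (A ++ [ q ]) S
    (≤-trans (≤-reflexive (trans (length-++ A) (+-comm (length A) 1))) room)
... | reject _ eq rewrite eq = kmaxLoop-length≤ k A S bound

SizeDecreasing : ∀ {n} → List (Subset n) → Set
SizeDecreasing = AllPairs (λ a b → ∣ b ∣ ≤ ∣ a ∣)

record Accepted {n} (k : ℕ) (A S : List (Subset n)) (r : Subset n) : Set where
  field
    room      : length A < k
    uncovered : ¬ Any (r ⊆_) A
    maximal   : ⊂-Maximal S r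

kmaxLoop-accepted : ∀ {n k} {A S : List (Subset n)} {r} → SizeDecreasing S →
                    r ∈ kmaxLoop k A S → r ∈ A ⊎ Accepted k A S r
kmaxLoop-accepted {S = []} _ r∈ = inj₁ r∈
kmaxLoop-accepted {k = k} {A} {q ∷ S} {r} (q-largest ∷ sorted) r∈ with kmaxStep k A q S
... | accept room q-uncovered eq = accepted (kmaxLoop-accepted sorted (subst (r ∈_) eq r∈))
  where
  q-maximal : ∀ {q'} → q' ∈ q ∷ S → ¬ q ⊂ q'
  q-maximal (here refl)  q⊂q  = <-irrefl refl (p⊂q⇒∣p∣<∣q∣ q⊂q)
  q-maximal (there q'∈S) q⊂q' = ≤⇒≯ (All.lookup q-largest q'∈S) (p⊂q⇒∣p∣<∣q∣ q⊂q')

  accepted : r ∈ A ++ [ q ] ⊎ Accepted k (A ++ [ q ]) S r → r ∈ A ⊎ Accepted k A (q ∷ S) r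
  accepted (inj₁ r∈A++q) with ∈-++⁻ A r∈A++q
  ... | inj₁ r∈A         = inj₁ r∈A
  ... | inj₂ (here refl) = inj₂ record
    { room = room ; uncovered = q-uncovered ; maximal = here refl , q-maximal }
  accepted (inj₂ record { uncovered = uncovered ; maximal = r∈S , unbeaten }) = inj₂ record
    { room      = room
    ; uncovered = uncovered ∘ ++⁺ˡ
    ; maximal   = there r∈S , λ
        { (here refl) r⊂q → uncovered (++⁺ʳ A (here (proj₁ r⊂q)))
        ; (there q'∈S)    → unbeaten q'∈S }
    }
... | reject reason eq with kmaxLoop-accepted sorted (subst (r ∈_) eq r∈)
...   | inj₁ r∈A = inj₁ r∈A
...   | inj₂ record { room = room ; uncovered = uncovered ; maximal = r∈S , unbeaten } = inj₂ record
  { room      = room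
  ; uncovered = uncovered
  ; maximal   = there r∈S , λ
      { (here refl) r⊂q → rejected reason (proj₁ r⊂q)
      ; (there q'∈S)    → unbeaten q'∈S }
  }
  where
  rejected : k ≤ length A ⊎ Any (q ⊆_) A → ¬ r ⊆ q
  rejected (inj₁ full)    _   = ≤⇒≯ full room
  rejected (inj₂ covered) r⊆q = uncovered (Any.map (⊆-trans r⊆q) covered)

IsKMax-length≤ : ∀ {n} {S : List (Subset n)} {k R} → IsKMax S k R → length R ≤ k
IsKMax-length≤ {k = k} (S' , _ , _ , refl) = kmaxLoop-length≤ k [] S' z≤n

IsKMax-⊂-Maximal : ∀ {n} {S : List (Subset n)} {k R r} → IsKMax S k R → r ∈ R → ⊂-Maximal S r
IsKMax-⊂-Maximal (S' , S'↭S , sorted , refl) r∈R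
  with kmaxLoop-accepted (Linked⇒AllPairs (λ b≤a c≤b → ≤-trans c≤b b≤a) sorted) r∈R
... | inj₁ ()
... | inj₂ record { maximal = r∈S' , unbeaten } =
  ∈-resp-↭ S'↭S r∈S' , λ q∈S → unbeaten (∈-resp-↭ (↭-sym S'↭S) q∈S)

record Enumerates {n} (G : Graph n) (β : ℚ) (s : ℕ) (search : Subset n → List (Subset n)) : Set where
  field
    sound    : ∀ {X q} → q ∈ search X → IsQC G β q × X ⊆ q × s ≤ ∣ q ∣
    complete : ∀ {X q} → IsQC G β q × X ⊆ q × s ≤ ∣ q ∣ → q ∈ search X

module _ {n} {G : Graph n} {β : ℚ} {s : ℕ} {search : Subset n → List (Subset n)}
         (enumerates : Enumerates G β s search) (seeds : List (Subset n)) where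

  open Enumerates enumerates

  ∈-enumerated⇒QC : ∀ {q} → q ∈ concatMap search seeds → IsQC G β q × s ≤ ∣ q ∣
  ∈-enumerated⇒QC q∈ with Any.satisfied (∈-concatMap⁻ search {xs = seeds} q∈)
  ... | _ , q∈search with sound q∈search
  ... | qc , _ , large = qc , large

  ∈-enumerated-⊂-upward : ∀ {r q} → r ∈ concatMap search seeds → r ⊂ q → IsQC G β q →
                          q ∈ concatMap search seeds
  ∈-enumerated-⊂-upward {r} {q} r∈ r⊂q qc =
    ∈-concatMap⁺ search {xs = seeds} (Any.map lift (∈-concatMap⁻ search {xs = seeds} r∈))
    where
    lift : ∀ {X} → r ∈ search X → q ∈ search X
    lift r∈search with sound r∈search
    ... | _ , X⊆r , large = complete
      (qc , ⊆-trans X⊆r (proj₁ r⊂q) , ≤-trans large (<⇒≤ (p⊂q⇒∣p∣<∣q∣ r⊂q)))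

lemma2 : ∀ {n} (G : Graph n) (γ γ' : ℚ) (s k k' : ℕ) →
    0ℚ ℚ.< γ → γ ℚ.< 1ℚ → γ ℚ.< γ' → γ' ℚ.≤ 1ℚ →
    1 ℕ.≤ s → 1 ℕ.≤ k → k ℕ.≤ k' →
    (QuickM : Subset n → ℚ → ℕ → List (Subset n)) →
    (∀ X β → 0ℚ ℚ.< β → β ℚ.≤ 1ℚ → ∀ q →
      (q L.∈ QuickM X β s → IsQC G β q × X ⊆ q × s ℕ.≤ ∣ q ∣) ×
      (IsQC G β q × X ⊆ q × s ℕ.≤ ∣ q ∣ → q L.∈ QuickM X β s)) →
    (Y : List (Subset n)) → IsKMax (QuickM ⊥ γ' s) k' Y →
    (R : List (Subset n)) → IsKMax (concatMap (λ q → QuickM q γ s) Y) k R →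
    length R ℕ.≤ k ×
    All (λ q → IsQC G γ q × s ℕ.≤ ∣ q ∣ × MaximalQC G γ q) R
lemma2 G γ γ' s k k' 0<γ γ<1 _ _ _ _ _ QuickM spec Y _ R R-kmax =
  IsKMax-length≤ R-kmax , tabulate maximalQC
  where
  enumerates : Enumerates G γ s (λ X → QuickM X γ s)
  enumerates = record
    { sound    = λ {X} {q} → proj₁ (spec X γ 0<γ (ℚ.<⇒≤ γ<1) q)
    ; complete = λ {X} {q} → proj₂ (spec X γ 0<γ (ℚ.<⇒≤ γ<1) q)
    }

  maximalQC : ∀ {r} → r ∈ R → IsQC G γ r × s ≤ ∣ r ∣ × MaximalQC G γ r
  maximalQC r∈R with IsKMax-⊂-Maximal R-kmax r∈R
  ... | r∈Z , unbeaten with ∈-enumerated⇒QC enumerates Y r∈Z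
  ... | qc , large = qc , large , qc , λ Q r⊂Q qcQ →
    unbeaten (∈-enumerated-⊂-upward enumerates Y r∈Z r⊂Q qcQ) r⊂Q
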